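{- Let $k\ge 1$ and $0\le r<k$ be integers, and let $n\ge 0$ be an integer. Let $$A_n(k,r,x)=\left(\binom{i-k+1+r}{j}x^k+\binom{i+1+r}{j+1}\right)_{i,j=0}^{n-1}.$$ Then $x^r\det A_n(k,r,x)=F^{(k)}_{kn+r}(x)$.
   Context: Binomial coefficients are generalized: for an integer $a$ (possibly negative) and an integer $m$, $\binom{a}{m}=\frac{a(a-1)\cdots(a-m+1)}{m!}$ if $m\ge 0$ and $\binom{a}{m}=0$ if $m<0$. For a positive integer $k$ and integer $N\ge 0$, the generalized Fibonacci polynomial is $F^{(k)}_N(x)=\sum_{j=0}^{\lfloor N/k\rfloor}\binom{N-(k-1)j}{j}x^{N-kj}$; equivalently $F^{(k)}_N(x)=x^N$ for $0\le N<k$ and $F^{(k)}_N(x)=xF^{(k)}_{N-1}(x)+F^{(k)}_{N-k}(x)$ for $N\ge k$. The determinant of a $0\times 0$ matrix is $1$. -}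

module Defs where

open import Level using (Level)
open import Data.Nat as ℕ using (ℕ; zero; suc; _∸_; _!)
import Data.Nat.Properties as ℕP
open import Data.Integer as ℤ using (ℤ; +_; -[1+_])
open import Data.Integer.DivMod using (_/_)
open import Data.Fin using (Fin; zero; suc; punchIn)
open import Algebra.Bundles using (CommutativeRing)

falling : ℤ → ℕ → ℤ
falling a zero    = + 1
falling a (suc m) = a ℤ.* falling (a ℤ.- + 1) m

-- Generalized binomial coefficient (a choose m) for integer a and m ≥ 0,
-- exactly as a(a-1)...(a-m+1)/m!  (exact division in ℤ).
binomℤ : ℤ → ℕ → ℤ
binomℤ a m = (falling a m / (+ (m !))) {{m ℕP.!≢0}}

module _ {c ℓ : Level} (R : CommutativeRing c ℓ) where
  open CommutativeRing R using (Carrier; _+_; _*_; -_; 0#; 1#)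

  natR : ℕ → Carrier
  natR zero    = 0#
  natR (suc n) = 1# + natR n

  intR : ℤ → Carrier
  intR (+ n)      = natR n
  intR -[1+ n ]   = - natR (suc n)

  pow : Carrier → ℕ → Carrier
  pow x zero    = 1#
  pow x (suc n) = x * pow x n

  sumTo : ℕ → (ℕ → Carrier) → Carrier
  sumTo zero    f = f 0
  sumTo (suc m) f = sumTo m f + f (suc m)

  sumFin : (n : ℕ) → (Fin n → Carrier) → Carrier
  sumFin zero    f = 0#
  sumFin (suc n) f = f zero + sumFin n (λ i → f (suc i))

  sign : ℕ → Carrier
  sign zero    = 1#
  sign (suc j) = - sign j

  det : (n : ℕ) → (Fin n → Fin n → Carrier) → Carrier
  det zero    M = 1#
  det (suc n) M =
    sumFin (suc n) (λ j →
      sign (Data.Fin.toℕ j) * (M zero j * det n (λ i l → M (suc i) (punchIn j l))))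

  -- Generalized Fibonacci polynomial evaluated at x:
  -- F^{(k)}_N(x) = Σ_{j=0}^{⌊N/k⌋} binom(N-(k-1)j, j) x^{N-kj}.
  -- Defined for k = suc k' (k ≥ 1); the k = 0 case is unused (returns 0).
  Fib : ℕ → ℕ → Carrier → Carrier
  Fib zero      N x = 0#
  Fib (suc k')  N x =
    sumTo (N ℕ./ suc k') (λ j →
      intR (binomℤ (+ N ℤ.- + (k' ℕ.* j)) j) * pow x (N ∸ suc k' ℕ.* j))

  A : (k r n : ℕ) → Carrier → Fin n → Fin n → Carrier
  A k r n x i j =
    intR (binomℤ (+ Data.Fin.toℕ i ℤ.- + k ℤ.+ + 1 ℤ.+ + r) (Data.Fin.toℕ j)) * pow x k
    + intR (binomℤ (+ Data.Fin.toℕ i ℤ.+ + 1 ℤ.+ + r) (suc (Data.Fin.toℕ j)))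

{-# OPTIONS --safe #-}
-- Put X = xᵏ. For an integer b let D_b(n) be the determinant of the n × n Toeplitz upper
-- Hessenberg matrix with first row ((b − k choose j) X + (b choose j + 1))_j. Row i of
-- A_n(k, r, x) is that first row for b = r + 1 + i, so by Pascal's rule bottom-up row
-- differencing turns A_n(k, r, x) into the matrix of D_{r+1}(n). Expanding along the first
-- row shows that Σₙ D_b(n) tⁿ is the reciprocal of (1 − t)ᵇ − X t (1 − t)ᵇ⁻ᵏ. Hence D_{b+1}
-- is the sequence of partial sums of D_b, and D_0(n + 1) = X D_k(n). For 0 ≤ r < k these two
-- recurrences identify D_{r+1}(n) with Σ_{i+m=n} (m + r + ki choose m) Xⁱ, which is
-- x⁻ʳ F^{(k)}_{kn+r}(x) after reindexing.
module Submission where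

open import Level using (Level)
open import Algebra.Bundles using (CommutativeRing)
open import Data.Nat as ℕ using (ℕ; zero; suc; s≤s; z≤n; _≤_; _<_; _∸_; _⊓_; _!)
import Data.Nat.Properties as ℕP
import Data.Nat.DivMod as ℕD
import Data.Nat.Divisibility as ℕDiv
open import Data.Nat.Tactic.RingSolver using () renaming (solve-∀ to ℕ-solve-∀)
open import Data.Integer as ℤ using (ℤ; +_; -[1+_])
import Data.Integer.Properties as ℤP
open import Data.Integer.DivMod using (_/_; _/ℕ_)
open import Data.Integer.Tactic.RingSolver using () renaming (solve-∀ to ℤ-solve-∀)
open import Data.Fin using (Fin; zero; suc; toℕ; punchIn; lift)
open import Data.Fin.Properties using (toℕ<n)
open import Data.Sum using (inj₁; inj₂)
open import Data.Maybe using (Maybe; just; nothing)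
open import Function using (_∘_)
open import Relation.Nullary using (yes; no; contradiction)
open import Relation.Binary.PropositionalEquality as ≡ using (_≡_; _≢_)
import Algebra.Solver.Ring.AlmostCommutativeRing as ACR
open import Defs

module IntegerBinomial where
  open import Relation.Binary.PropositionalEquality
  open import Data.Integer using (_+_; _*_; _-_; -_)
  open import Data.Integer.Tactic.RingSolver using (solve-∀)
  open ≡-Reasoning

  binomial : ℤ → ℕ → ℤ
  binomial a zero = + 1
  binomial (+ zero) (suc m) = + 0
  binomial (+ suc n) (suc m) = binomial (+ n) (suc m) + binomial (+ n) m
  binomial -[1+ zero ] (suc m) = - binomial -[1+ zero ] m
  binomial -[1+ suc n ] (suc m) = binomial -[1+ n ] (suc m) - binomial -[1+ suc n ] m

  binomial-pascal : ∀ a m → binomial (ℤ.suc a) (suc m) ≡ binomial a (suc m) + binomial a m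
  binomial-pascal (+ n) m = refl
  binomial-pascal -[1+ zero ] m = sym (ℤP.+-inverseˡ (binomial -[1+ zero ] m))
  binomial-pascal -[1+ suc n ] m = x≡[x-y]+y (binomial -[1+ n ] (suc m)) (binomial -[1+ suc n ] m)
    where
    x≡[x-y]+y : ∀ x y → x ≡ (x - y) + y
    x≡[x-y]+y = solve-∀

  m<j⇒binomial≡0 : ∀ m j → m < j → binomial (+ m) j ≡ + 0
  m<j⇒binomial≡0 zero (suc j) _ = refl
  m<j⇒binomial≡0 (suc m) (suc j) (s≤s m<j) =
    cong₂ _+_ (m<j⇒binomial≡0 m (suc j) (ℕP.m<n⇒m<1+n m<j)) (m<j⇒binomial≡0 m j m<j)

  falling-pascal : ∀ a m → falling (ℤ.suc a) (suc m) ≡ falling a (suc m) + + suc m * falling a m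
  falling-pascal a m = begin
      ℤ.suc a * falling (ℤ.suc a - + 1) m  ≡⟨ cong (λ b → ℤ.suc a * falling b m) (suc[a]-1≡a a) ⟩
      ℤ.suc a * falling a m                ≡⟨ expand a (falling a m) (+ m) ⟩
      falling a m * (a - + m) + + suc m * falling a m
                                           ≡⟨ cong (_+ + suc m * falling a m) (sym (falling-suc a m)) ⟩
      falling a (suc m) + + suc m * falling a m ∎
    where
    suc[a]-1≡a : ∀ a → (+ 1 + a) - + 1 ≡ a
    suc[a]-1≡a = solve-∀
    expand : ∀ a f m → (+ 1 + a) * f ≡ f * (a - m) + (+ 1 + m) * f
    expand = solve-∀
    falling-suc : ∀ a m → falling a (suc m) ≡ falling a m * (a - + m)
    falling-suc a zero = a*1≡1*[a-0] a
      where
      a*1≡1*[a-0] : ∀ a → a * + 1 ≡ + 1 * (a - + 0)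
      a*1≡1*[a-0] = solve-∀
    falling-suc a (suc m) = begin
        a * falling (a - + 1) (suc m)                ≡⟨ cong (a *_) (falling-suc (a - + 1) m) ⟩
        a * (falling (a - + 1) m * ((a - + 1) - + m)) ≡⟨ reassoc a (falling (a - + 1) m) (+ m) ⟩
        a * falling (a - + 1) m * (a - (+ 1 + + m))  ∎
      where
      reassoc : ∀ a f m → a * (f * ((a - + 1) - m)) ≡ (a * f) * (a - (+ 1 + m))
      reassoc = solve-∀

  private
    +[suc-m]! : ∀ m → + (suc m !) ≡ + suc m * + (m !)
    +[suc-m]! m = ℤP.pos-* (suc m) (m !)

  falling-step-up : ∀ a m →
    falling a m ≡ binomial a m * + (m !) →
    falling a (suc m) ≡ binomial a (suc m) * + (suc m !) →
    falling (ℤ.suc a) (suc m) ≡ binomial (ℤ.suc a) (suc m) * + (suc m !)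
  falling-step-up a m IH₀ IH₁ = begin
      falling (ℤ.suc a) (suc m)
        ≡⟨ falling-pascal a m ⟩
      falling a (suc m) + + suc m * falling a m
        ≡⟨ cong₂ (λ u v → u + + suc m * v) IH₁ IH₀ ⟩
      binomial a (suc m) * + (suc m !) + + suc m * (binomial a m * + (m !))
        ≡⟨ cong (λ f → binomial a (suc m) * f + + suc m * (binomial a m * + (m !))) (+[suc-m]! m) ⟩
      binomial a (suc m) * (+ suc m * + (m !)) + + suc m * (binomial a m * + (m !))
        ≡⟨ collect (binomial a (suc m)) (binomial a m) (+ suc m) (+ (m !)) ⟩
      (binomial a (suc m) + binomial a m) * (+ suc m * + (m !))
        ≡⟨ cong₂ _*_ (sym (binomial-pascal a m)) (sym (+[suc-m]! m)) ⟩
      binomial (ℤ.suc a) (suc m) * + (suc m !) ∎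
    where
    collect : ∀ b₁ b₀ s f → b₁ * (s * f) + s * (b₀ * f) ≡ (b₁ + b₀) * (s * f)
    collect = solve-∀

  falling-step-down : ∀ a m →
    falling a m ≡ binomial a m * + (m !) →
    falling (ℤ.suc a) (suc m) ≡ binomial (ℤ.suc a) (suc m) * + (suc m !) →
    falling a (suc m) ≡ binomial a (suc m) * + (suc m !)
  falling-step-down a m IH₀ IH₁ = begin
      falling a (suc m)
        ≡⟨ x≡[x+y]-y (falling a (suc m)) (+ suc m * falling a m) ⟩
      (falling a (suc m) + + suc m * falling a m) - + suc m * falling a m
        ≡⟨ cong₂ (λ u v → u - + suc m * v) (sym (falling-pascal a m)) IH₀ ⟩
      falling (ℤ.suc a) (suc m) - + suc m * (binomial a m * + (m !))
        ≡⟨ cong (_- + suc m * (binomial a m * + (m !))) IH₁ ⟩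
      binomial (ℤ.suc a) (suc m) * + (suc m !) - + suc m * (binomial a m * + (m !))
        ≡⟨ cong₂ (λ b f → b * f - + suc m * (binomial a m * + (m !))) (binomial-pascal a m) (+[suc-m]! m) ⟩
      (binomial a (suc m) + binomial a m) * (+ suc m * + (m !)) - + suc m * (binomial a m * + (m !))
        ≡⟨ cancel (binomial a (suc m)) (binomial a m) (+ suc m) (+ (m !)) ⟩
      binomial a (suc m) * (+ suc m * + (m !))
        ≡⟨ cong (binomial a (suc m) *_) (sym (+[suc-m]! m)) ⟩
      binomial a (suc m) * + (suc m !) ∎
    where
    x≡[x+y]-y : ∀ x y → x ≡ (x + y) - y
    x≡[x+y]-y = solve-∀
    cancel : ∀ b₁ b₀ s f → (b₁ + b₀) * (s * f) - s * (b₀ * f) ≡ b₁ * (s * f)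
    cancel = solve-∀

  falling≡binomial*! : ∀ a m → falling a m ≡ binomial a m * + (m !)
  falling≡binomial*! a zero = refl
  falling≡binomial*! (+ zero) (suc m) = ℤP.*-zeroˡ (falling (+ 0 - + 1) m)
  falling≡binomial*! (+ suc n) (suc m) =
    falling-step-up (+ n) m (falling≡binomial*! (+ n) m) (falling≡binomial*! (+ n) (suc m))
  falling≡binomial*! -[1+ zero ] (suc m) =
    falling-step-down -[1+ 0 ] m (falling≡binomial*! -[1+ 0 ] m) (falling≡binomial*! (+ 0) (suc m))
  falling≡binomial*! -[1+ suc n ] (suc m) =
    falling-step-down -[1+ suc n ] m (falling≡binomial*! -[1+ suc n ] m) (falling≡binomial*! -[1+ n ] (suc m))

  [b*d]/d≡b : ∀ b d .{{_ : ℕ.NonZero d}} → (b * + d) / + d ≡ b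
  [b*d]/d≡b (+ b) d@(suc _) = begin
      (+ b * + d) / + d   ≡⟨ ℤP.*-identityˡ ((+ b * + d) /ℕ d) ⟩
      (+ b * + d) /ℕ d    ≡⟨ cong (_/ℕ d) (sym (ℤP.pos-* b d)) ⟩
      + (b ℕ.* d ℕ./ d)   ≡⟨ cong +_ (ℕD.m*n/n≡m b d) ⟩
      + b                 ∎
  [b*d]/d≡b -[1+ b ] d@(suc _) =
    trans (ℤP.*-identityˡ ((-[1+ b ] * + d) /ℕ d)) (negative (ℕD.m*n%n≡0 (suc b) d))
    where
    negative : (suc b ℕ.* d) ℕ.% d ≡ 0 → (-[1+ b ] * + d) /ℕ d ≡ -[1+ b ]
    negative eq with suc b ℕ.* d ℕ.% d
    ... | zero = cong (λ u → - (+ u)) (ℕD.m*n/n≡m (suc b) d)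
    negative () | suc _

  binomℤ≡binomial : ∀ a m → binomℤ a m ≡ binomial a m
  binomℤ≡binomial a m = begin
      (falling a m / + (m !)) {{m ℕP.!≢0}}
        ≡⟨ cong (λ u → (u / + (m !)) {{m ℕP.!≢0}}) (falling≡binomial*! a m) ⟩
      (binomial a m * + (m !) / + (m !)) {{m ℕP.!≢0}}
        ≡⟨ [b*d]/d≡b (binomial a m) (m !) {{m ℕP.!≢0}} ⟩
      binomial a m ∎

  -- binomialSub a j s is (a choose j − s), which is zero when s > j.
  binomialSub : ℤ → ℕ → ℕ → ℤ
  binomialSub a j zero = binomial a j
  binomialSub a zero (suc s) = + 0
  binomialSub a (suc j) (suc s) = binomialSub a j s

  binomialSub-pascal : ∀ a j s → binomialSub (ℤ.suc a) j s ≡ binomialSub a j s + binomialSub a j (suc s)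
  binomialSub-pascal a zero zero = refl
  binomialSub-pascal a (suc j) zero = binomial-pascal a j
  binomialSub-pascal a zero (suc s) = refl
  binomialSub-pascal a (suc j) (suc s) = binomialSub-pascal a j s

open IntegerBinomial

module _ {c ℓ : Level} (R : CommutativeRing c ℓ) where
  open CommutativeRing R hiding (zero)
  open import Algebra.Properties.Ring ring using (-‿involutive; -‿distribˡ-*; -‿distribʳ-*; -‿+-comm; -0#≈0#)
  open import Relation.Binary.Reasoning.Setoid setoid
  open import Data.Vec.Functional.Relation.Binary.Equality.Setoid setoid using (_≋_; ≋-refl; ≋-sym; ≋-trans; ≋-reflexive)

  natR-+ : ∀ m n → natR R (m ℕ.+ n) ≈ natR R m + natR R n
  natR-+ zero n = sym (+-identityˡ _)
  natR-+ (suc m) n = trans (+-congˡ (natR-+ m n)) (sym (+-assoc _ _ _))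

  natR-* : ∀ m n → natR R (m ℕ.* n) ≈ natR R m * natR R n
  natR-* zero n = sym (zeroˡ _)
  natR-* (suc m) n = begin
    natR R (n ℕ.+ m ℕ.* n)              ≈⟨ natR-+ n (m ℕ.* n) ⟩
    natR R n + natR R (m ℕ.* n)         ≈⟨ +-cong (sym (*-identityˡ _)) (natR-* m n) ⟩
    1# * natR R n + natR R m * natR R n ≈⟨ sym (distribʳ _ _ _) ⟩
    (1# + natR R m) * natR R n          ∎

  intR-neg : ∀ a → intR R (ℤ.- a) ≈ - intR R a
  intR-neg (+ zero) = sym -0#≈0#
  intR-neg (+ suc n) = refl
  intR-neg -[1+ n ] = sym (-‿involutive _)

  intR-⊖ : ∀ m n → intR R (m ℤ.⊖ n) ≈ natR R m - natR R n
  intR-⊖ zero zero = sym (-‿inverseʳ 0#)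
  intR-⊖ zero (suc n) = sym (+-identityˡ _)
  intR-⊖ (suc m) zero = sym (trans (+-congˡ -0#≈0#) (+-identityʳ _))
  intR-⊖ (suc m) (suc n) = begin
      intR R (suc m ℤ.⊖ suc n)   ≡⟨ ≡.cong (intR R) (ℤP.[1+m]⊖[1+n]≡m⊖n m n) ⟩
      intR R (m ℤ.⊖ n)           ≈⟨ intR-⊖ m n ⟩
      natR R m - natR R n        ≈⟨ a-b≈[1+a]-[1+b] (natR R m) (natR R n) ⟩
      (1# + natR R m) - (1# + natR R n) ∎
    where
    a-b≈[1+a]-[1+b] : ∀ a b → a - b ≈ (1# + a) - (1# + b)
    a-b≈[1+a]-[1+b] a b = begin
      a - b                     ≈⟨ sym (+-identityˡ _) ⟩
      0# + (a - b)              ≈⟨ +-congʳ (sym (-‿inverseʳ 1#)) ⟩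
      (1# - 1#) + (a - b)       ≈⟨ +-assoc _ _ _ ⟩
      1# + (- 1# + (a - b))     ≈⟨ +-congˡ (trans (sym (+-assoc _ _ _)) (trans (+-congʳ (+-comm _ _)) (+-assoc _ _ _))) ⟩
      1# + (a + (- 1# - b))     ≈⟨ sym (+-assoc _ _ _) ⟩
      (1# + a) + (- 1# - b)     ≈⟨ +-congˡ (-‿+-comm 1# b) ⟩
      (1# + a) - (1# + b)       ∎

  intR-+ : ∀ a b → intR R (a ℤ.+ b) ≈ intR R a + intR R b
  intR-+ (+ m) (+ n) = natR-+ m n
  intR-+ (+ m) -[1+ n ] = intR-⊖ m (suc n)
  intR-+ -[1+ m ] (+ n) = trans (intR-⊖ n (suc m)) (+-comm _ _)
  intR-+ -[1+ m ] -[1+ n ] = begin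
      - natR R (suc (suc (m ℕ.+ n)))      ≡⟨ ≡.cong (λ t → - natR R (suc t)) (≡.sym (ℕP.+-suc m n)) ⟩
      - natR R (suc m ℕ.+ suc n)          ≈⟨ -‿cong (natR-+ (suc m) (suc n)) ⟩
      - (natR R (suc m) + natR R (suc n)) ≈⟨ sym (-‿+-comm _ _) ⟩
      - natR R (suc m) + - natR R (suc n) ∎

  intR-*-pos : ∀ a n → intR R (a ℤ.* + n) ≈ intR R a * intR R (+ n)
  intR-*-pos (+ m) n = trans (reflexive (≡.cong (intR R) (≡.sym (ℤP.pos-* m n)))) (natR-* m n)
  intR-*-pos -[1+ m ] n = begin
      intR R (ℤ.- (+ suc m) ℤ.* + n)          ≡⟨ ≡.cong (intR R) (≡.sym (ℤP.neg-distribˡ-* (+ suc m) (+ n))) ⟩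
      intR R (ℤ.- (+ suc m ℤ.* + n))          ≈⟨ intR-neg (+ suc m ℤ.* + n) ⟩
      - intR R (+ suc m ℤ.* + n)              ≈⟨ -‿cong (intR-*-pos (+ suc m) n) ⟩
      - (intR R (+ suc m) * intR R (+ n))     ≈⟨ -‿distribˡ-* _ _ ⟩
      - intR R (+ suc m) * intR R (+ n)       ∎

  intR-* : ∀ a b → intR R (a ℤ.* b) ≈ intR R a * intR R b
  intR-* a (+ n) = intR-*-pos a n
  intR-* a -[1+ n ] = begin
      intR R (a ℤ.* ℤ.- (+ suc n))        ≡⟨ ≡.cong (intR R) (≡.sym (ℤP.neg-distribʳ-* a (+ suc n))) ⟩
      intR R (ℤ.- (a ℤ.* + suc n))        ≈⟨ intR-neg (a ℤ.* + suc n) ⟩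
      - intR R (a ℤ.* + suc n)            ≈⟨ -‿cong (intR-*-pos a (suc n)) ⟩
      - (intR R a * intR R (+ suc n))     ≈⟨ -‿distribʳ-* _ _ ⟩
      intR R a * - intR R (+ suc n)       ∎

  intR-morphism : CommutativeRing.rawRing ℤP.+-*-commutativeRing ACR.-Raw-AlmostCommutative⟶ ACR.fromCommutativeRing R
  intR-morphism = record
    { ⟦_⟧ = intR R ; +-homo = intR-+ ; *-homo = intR-* ; -‿homo = intR-neg
    ; 0-homo = refl ; 1-homo = +-identityʳ 1# }

  intR-≟ : ∀ a b → Maybe (ACR.Induced-equivalence intR-morphism a b)
  intR-≟ a b with a ℤ.≟ b
  ... | yes ≡.refl = just refl
  ... | no _ = nothing

  open import Algebra.Solver.Ring (CommutativeRing.rawRing ℤP.+-*-commutativeRing) (ACR.fromCommutativeRing R) intR-morphism intR-≟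
    using (solve; _:=_; _:+_; _:*_; :-_; _:-_; con)

  sumFin-cong : ∀ n {f g : Fin n → Carrier} → (∀ i → f i ≈ g i) → sumFin R n f ≈ sumFin R n g
  sumFin-cong zero f≈g = refl
  sumFin-cong (suc n) f≈g = +-cong (f≈g zero) (sumFin-cong n (λ i → f≈g (suc i)))

  sumFin-+ : ∀ n (f g : Fin n → Carrier) → sumFin R n (λ i → f i + g i) ≈ sumFin R n f + sumFin R n g
  sumFin-+ zero f g = sym (+-identityʳ 0#)
  sumFin-+ (suc n) f g = trans (+-congˡ (sumFin-+ n _ _)) (interchange (f zero) (g zero) _ _)
    where
    interchange : ∀ a b c d → (a + b) + (c + d) ≈ (a + c) + (b + d)
    interchange = solve 4 (λ a b c d → (a :+ b) :+ (c :+ d) := (a :+ c) :+ (b :+ d)) refl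

  sumFin-zero : ∀ n (f : Fin n → Carrier) → (∀ i → f i ≈ 0#) → sumFin R n f ≈ 0#
  sumFin-zero zero f f≈0 = refl
  sumFin-zero (suc n) f f≈0 = trans (+-cong (f≈0 zero) (sumFin-zero n _ (λ i → f≈0 (suc i)))) (+-identityʳ 0#)

  sumFin-*ˡ : ∀ n a (f : Fin n → Carrier) → sumFin R n (λ i → a * f i) ≈ a * sumFin R n f
  sumFin-*ˡ zero a f = sym (zeroʳ a)
  sumFin-*ˡ (suc n) a f = trans (+-congˡ (sumFin-*ˡ n a (λ i → f (suc i)))) (sym (distribˡ a _ _))

  sumFin-neg : ∀ n (f : Fin n → Carrier) → sumFin R n (λ i → - f i) ≈ - sumFin R n f
  sumFin-neg zero f = sym -0#≈0#
  sumFin-neg (suc n) f = trans (+-congˡ (sumFin-neg n (λ i → f (suc i)))) (-‿+-comm _ _)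

  Row : ℕ → Set c
  Row n = Fin n → Carrier

  Matrix : ℕ → Set c
  Matrix n = Fin n → Fin n → Carrier

  minor : ∀ {n} → Matrix (suc n) → Fin (suc n) → Matrix n
  minor M j i l = M (suc i) (punchIn j l)

  laplaceTerm : ∀ n → Matrix (suc n) → Fin (suc n) → Carrier
  laplaceTerm n M j = sign R (toℕ j) * (M zero j * det R n (minor M j))

  det-cong : ∀ n {M N : Matrix n} → (∀ i j → M i j ≈ N i j) → det R n M ≈ det R n N
  det-cong zero M≈N = refl
  det-cong (suc n) {M} {N} M≈N =
    sumFin-cong (suc n) {laplaceTerm n M} {laplaceTerm n N} (λ j → *-congˡ (*-cong (M≈N zero j) (det-cong n (λ i l → M≈N (suc i) (punchIn j l)))))

  det-zero-column : ∀ n (M : Matrix (suc n)) → (∀ i → M i zero ≈ 0#) → det R (suc n) M ≈ 0#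

  laplaceTerms-suc≈0 : ∀ n (M : Matrix (suc n)) → (∀ i → M (suc i) zero ≈ 0#) →
    sumFin R n (λ j → laplaceTerm n M (suc j)) ≈ 0#
  laplaceTerms-suc≈0 zero M _ = refl
  laplaceTerms-suc≈0 (suc n) M M₀≈0 = sumFin-zero (suc n) (λ j → laplaceTerm (suc n) M (suc j)) (λ j →
    trans (*-congˡ (*-congˡ (det-zero-column n (minor M (suc j)) M₀≈0))) (trans (*-congˡ (zeroʳ _)) (zeroʳ _)))

  det-zero-column n M M₀≈0 = trans (+-cong first (laplaceTerms-suc≈0 n M (M₀≈0 ∘ suc))) (+-identityʳ 0#)
    where
    first : laplaceTerm n M zero ≈ 0#
    first = trans (*-congˡ (trans (*-congʳ (M₀≈0 zero)) (zeroˡ _))) (zeroʳ _)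

  rows : ∀ {n} → (ℕ → Row n) → Matrix n
  rows ρ i = ρ (toℕ i)

  minorRows : ∀ {n} → Fin (suc n) → (ℕ → Row (suc n)) → ℕ → Row n
  minorRows j ρ i l = ρ (suc i) (punchIn j l)

  det-laplace-+ : ∀ n (M M₁ M₂ : Matrix (suc n)) →
    (∀ j → laplaceTerm n M j ≈ laplaceTerm n M₁ j + laplaceTerm n M₂ j) →
    det R (suc n) M ≈ det R (suc n) M₁ + det R (suc n) M₂
  det-laplace-+ n M M₁ M₂ split =
    trans (sumFin-cong (suc n) {laplaceTerm n M} split) (sumFin-+ (suc n) (laplaceTerm n M₁) (laplaceTerm n M₂))

  det-row-+ : ∀ n m (ρ ρ₁ ρ₂ : ℕ → Row n) → m < n →
    (∀ i → i ≢ m → ρ₁ i ≋ ρ i) → (∀ i → i ≢ m → ρ₂ i ≋ ρ i) →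
    (∀ j → ρ m j ≈ ρ₁ m j + ρ₂ m j) →
    det R n (rows ρ) ≈ det R n (rows ρ₁) + det R n (rows ρ₂)
  det-row-+ (suc n) zero ρ ρ₁ ρ₂ _ ρ₁≋ρ ρ₂≋ρ ρ₀≈ = det-laplace-+ n (rows ρ) (rows ρ₁) (rows ρ₂) split
    where
    split : ∀ j → laplaceTerm n (rows ρ) j ≈ laplaceTerm n (rows ρ₁) j + laplaceTerm n (rows ρ₂) j
    split j = begin
        s * (ρ 0 j * d ρ)                        ≈⟨ *-congˡ (*-congʳ (ρ₀≈ j)) ⟩
        s * ((ρ₁ 0 j + ρ₂ 0 j) * d ρ)            ≈⟨ expand s (ρ₁ 0 j) (ρ₂ 0 j) (d ρ) ⟩
        s * (ρ₁ 0 j * d ρ) + s * (ρ₂ 0 j * d ρ)  ≈⟨ +-cong (*-congˡ (*-congˡ (same-minor ρ₁ ρ₁≋ρ)))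
                                                            (*-congˡ (*-congˡ (same-minor ρ₂ ρ₂≋ρ))) ⟩
        s * (ρ₁ 0 j * d ρ₁) + s * (ρ₂ 0 j * d ρ₂) ∎
      where
      s = sign R (toℕ j)
      d : (ℕ → Row (suc n)) → Carrier
      d σ = det R n (rows (minorRows j σ))
      expand : ∀ s a b d → s * ((a + b) * d) ≈ s * (a * d) + s * (b * d)
      expand = solve 4 (λ s a b d → s :* ((a :+ b) :* d) := s :* (a :* d) :+ s :* (b :* d)) refl
      same-minor : ∀ σ → (∀ i → i ≢ 0 → σ i ≋ ρ i) → d ρ ≈ d σ
      same-minor σ σ≋ρ = det-cong n (λ i l → sym (σ≋ρ (suc (toℕ i)) (λ ()) _))
  det-row-+ (suc n) (suc m) ρ ρ₁ ρ₂ (s≤s m<n) ρ₁≋ρ ρ₂≋ρ ρₘ≈ = det-laplace-+ n (rows ρ) (rows ρ₁) (rows ρ₂) split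
    where
    split : ∀ j → laplaceTerm n (rows ρ) j ≈ laplaceTerm n (rows ρ₁) j + laplaceTerm n (rows ρ₂) j
    split j = begin
        s * (ρ 0 j * d ρ)                        ≈⟨ *-congˡ (*-congˡ (det-row-+ n m (minorRows j ρ) (minorRows j ρ₁) (minorRows j ρ₂) m<n
                                                      (λ i i≢m l → ρ₁≋ρ (suc i) (λ e → i≢m (ℕP.suc-injective e)) _)
                                                      (λ i i≢m l → ρ₂≋ρ (suc i) (λ e → i≢m (ℕP.suc-injective e)) _)
                                                      (λ l → ρₘ≈ _))) ⟩
        s * (ρ 0 j * (d ρ₁ + d ρ₂))              ≈⟨ expand s (ρ 0 j) (d ρ₁) (d ρ₂) ⟩
        s * (ρ 0 j * d ρ₁) + s * (ρ 0 j * d ρ₂)  ≈⟨ +-cong (*-congˡ (*-congʳ (sym (ρ₁≋ρ 0 (λ ()) j))))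
                                                            (*-congˡ (*-congʳ (sym (ρ₂≋ρ 0 (λ ()) j)))) ⟩
        s * (ρ₁ 0 j * d ρ₁) + s * (ρ₂ 0 j * d ρ₂) ∎
      where
      s = sign R (toℕ j)
      d : (ℕ → Row (suc n)) → Carrier
      d σ = det R n (rows (minorRows j σ))
      expand : ∀ s a b d → s * (a * (b + d)) ≈ s * (a * b) + s * (a * d)
      expand = solve 4 (λ s a b d → s :* (a :* (b :+ d)) := s :* (a :* b) :+ s :* (a :* d)) refl

  Extensional : ∀ {n m} → ((Fin n → Fin m) → Carrier) → Set ℓ
  Extensional Φ = ∀ g h → (∀ x → g x ≡ h x) → Φ g ≈ Φ h

  -- The Laplace expansion along two rows u, w; Φ g stands for the determinant of the
  -- remaining rows restricted to the columns selected by g.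
  twoRowExpansion : ∀ n → Row (suc (suc n)) → Row (suc (suc n)) → ((Fin n → Fin (suc (suc n))) → Carrier) → Carrier
  twoRowExpansion n u w Φ = sumFin R (suc (suc n)) (λ j → sign R (toℕ j) *
    (u j * sumFin R (suc n) (λ l → sign R (toℕ l) * (w (punchIn j l) * Φ (punchIn j ∘ punchIn l)))))

  expansionOffColumn₀ : ∀ n → Row (suc (suc n)) → ((Fin n → Fin (suc (suc n))) → Carrier) → Carrier
  expansionOffColumn₀ n w Φ = sumFin R (suc n) (λ l → sign R (toℕ l) * (w (suc l) * Φ (suc ∘ punchIn l)))

  -- Split off the terms in which u or w uses column 0.
  twoRowExpansion-peel : ∀ n u w Φ → Extensional {suc n} Φ →
    twoRowExpansion (suc n) u w Φ
      ≈ (u zero * expansionOffColumn₀ (suc n) w Φ - w zero * expansionOffColumn₀ (suc n) u Φ)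
        + twoRowExpansion n (u ∘ suc) (w ∘ suc) (Φ ∘ lift 1)
  twoRowExpansion-peel n u w Φ Φ-ext = begin
      twoRowExpansion (suc n) u w Φ
    ≈⟨ +-cong (*-identityˡ _) (sumFin-cong (suc (suc n)) {term} {λ j → - (w zero * y j) + z j} split) ⟩
      u zero * E w + sumFin R (suc (suc n)) (λ j → - (w zero * y j) + z j)
    ≈⟨ +-congˡ (sumFin-+ (suc (suc n)) (λ j → - (w zero * y j)) z) ⟩
      u zero * E w + (sumFin R (suc (suc n)) (λ j → - (w zero * y j)) + rest)
    ≈⟨ +-congˡ (+-congʳ (trans (sumFin-neg (suc (suc n)) (λ j → w zero * y j)) (-‿cong (sumFin-*ˡ (suc (suc n)) (w zero) y)))) ⟩
      u zero * E w + (- (w zero * E u) + rest)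
    ≈⟨ sym (+-assoc _ _ _) ⟩
      (u zero * E w - w zero * E u) + rest
    ∎
    where
    E : Row (suc (suc (suc n))) → Carrier
    E v = expansionOffColumn₀ (suc n) v Φ
    rest = twoRowExpansion n (u ∘ suc) (w ∘ suc) (Φ ∘ lift 1)
    Zterm : Fin (suc (suc n)) → Fin (suc n) → Carrier
    Zterm j l = sign R (toℕ l) * (w (suc (punchIn j l)) * Φ (lift 1 (punchIn j ∘ punchIn l)))
    Z : Fin (suc (suc n)) → Carrier
    Z j = sumFin R (suc n) (Zterm j)
    y z : Fin (suc (suc n)) → Carrier
    y j = sign R (toℕ j) * (u (suc j) * Φ (suc ∘ punchIn j))
    z j = sign R (toℕ j) * (u (suc j) * Z j)
    inner : Fin (suc (suc n)) → Fin (suc (suc n)) → Carrier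
    inner j l = sign R (toℕ l) * (w (punchIn (suc j) l) * Φ (punchIn (suc j) ∘ punchIn l))
    term : Fin (suc (suc n)) → Carrier
    term j = sign R (toℕ (suc j)) * (u (suc j) * sumFin R (suc (suc n)) (inner j))
    punchIn-lift : ∀ j l x → punchIn (suc j) (punchIn (suc l) x) ≡ lift 1 (punchIn j ∘ punchIn l) x
    punchIn-lift j l zero = ≡.refl
    punchIn-lift j l (suc x) = ≡.refl
    inner-sum : ∀ j → sumFin R (suc (suc n)) (inner j) ≈ w zero * Φ (suc ∘ punchIn j) - Z j
    inner-sum j = +-cong (*-identityˡ _) (trans
      (sumFin-cong (suc n) {inner j ∘ suc} {λ l → - Zterm j l}
        (λ l → trans (*-congˡ (*-congˡ (Φ-ext _ _ (punchIn-lift j l)))) (sym (-‿distribˡ-* _ _))))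
      (sumFin-neg (suc n) (Zterm j)))
    split : ∀ j → term j ≈ - (w zero * y j) + z j
    split j = trans (*-congˡ (*-congˡ (inner-sum j)))
      (solve 5 (λ s a b p q → (:- s) :* (a :* (b :* p :- q)) := :- (b :* (s :* (a :* p))) :+ s :* (a :* q)) refl
             (sign R (toℕ j)) (u (suc j)) (w zero) (Φ (suc ∘ punchIn j)) (Z j))

  twoRowExpansion-equal-rows : ∀ n u w Φ → Extensional {n} Φ → u ≋ w → twoRowExpansion n u w Φ ≈ 0#
  twoRowExpansion-equal-rows zero u w Φ Φ-ext u≋w = begin
      twoRowExpansion zero u w Φ
    ≈⟨ +-cong (*-congˡ (*-congˡ (+-congʳ (*-congˡ (*-cong (sym (u≋w (suc zero))) (Φ-ext _ _ (λ ())))))))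
              (+-congʳ (*-congˡ (*-congˡ (+-congʳ (*-congˡ (*-congʳ (sym (u≋w zero)))))))) ⟩
      1# * (u zero * (1# * (u (suc zero) * P) + 0#)) + ((- 1#) * (u (suc zero) * (1# * (u zero * P) + 0#)) + 0#)
    ≈⟨ cancel 1# (u zero) (u (suc zero)) P ⟩
      0#
    ∎
    where
    P = Φ (punchIn (suc zero) ∘ punchIn zero)
    cancel : ∀ o a b p → o * (a * (o * (b * p) + 0#)) + ((- o) * (b * (o * (a * p) + 0#)) + 0#) ≈ 0#
    cancel = solve 4 (λ o a b p →
      o :* (a :* (o :* (b :* p) :+ con (+ 0))) :+ ((:- o) :* (b :* (o :* (a :* p) :+ con (+ 0))) :+ con (+ 0)) := con (+ 0)) refl
  twoRowExpansion-equal-rows (suc n) u w Φ Φ-ext u≋w = begin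
      twoRowExpansion (suc n) u w Φ
    ≈⟨ twoRowExpansion-peel n u w Φ Φ-ext ⟩
      (u zero * expansionOffColumn₀ (suc n) w Φ - w zero * expansionOffColumn₀ (suc n) u Φ)
        + twoRowExpansion n (u ∘ suc) (w ∘ suc) (Φ ∘ lift 1)
    ≈⟨ +-cong (+-cong (*-congʳ (u≋w zero)) (-‿cong (*-congˡ (sumFin-cong (suc (suc n)) {λ l → sign R (toℕ l) * (u (suc l) * Φ (suc ∘ punchIn l))}
                                                                 (λ l → *-congˡ (*-congʳ (u≋w (suc l))))))))
              (twoRowExpansion-equal-rows n (u ∘ suc) (w ∘ suc) (Φ ∘ lift 1) (λ g h g≗h → Φ-ext _ _ (lift-cong g≗h)) (u≋w ∘ suc)) ⟩
      (w zero * expansionOffColumn₀ (suc n) w Φ - w zero * expansionOffColumn₀ (suc n) w Φ) + 0#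
    ≈⟨ trans (+-identityʳ _) (-‿inverseʳ _) ⟩
      0#
    ∎
    where
    lift-cong : ∀ {g h : Fin n → Fin (suc (suc n))} → (∀ x → g x ≡ h x) → ∀ x → lift 1 g x ≡ lift 1 h x
    lift-cong g≗h zero = ≡.refl
    lift-cong g≗h (suc x) = ≡.cong suc (g≗h x)

  det-adjacent-equal-rows : ∀ n m (ρ : ℕ → Row n) → suc m < n → ρ m ≋ ρ (suc m) → det R n (rows ρ) ≈ 0#
  det-adjacent-equal-rows (suc (suc n)) zero ρ _ ρ₀≋ρ₁ =
    twoRowExpansion-equal-rows n (ρ 0) (ρ 1) (λ g → det R n (λ i l → ρ (suc (suc (toℕ i))) (g l)))
      (λ g h g≗h → det-cong n (λ i l → reflexive (≡.cong (ρ (suc (suc (toℕ i)))) (g≗h l)))) ρ₀≋ρ₁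
  det-adjacent-equal-rows (suc n) (suc m) ρ (s≤s m<n) ρₘ≋ρₘ₊₁ =
    sumFin-zero (suc n) (laplaceTerm n (rows ρ)) (λ j →
      trans (*-congˡ (*-congˡ (det-adjacent-equal-rows n m (minorRows j ρ) m<n (λ l → ρₘ≋ρₘ₊₁ _))))
            (trans (*-congˡ (zeroʳ _)) (zeroʳ _)))

  update : ∀ {n} → (ℕ → Row n) → ℕ → Row n → ℕ → Row n
  update ρ m v i with i ℕ.≟ m
  ... | yes _ = v
  ... | no _ = ρ i

  update-hit : ∀ {n} (ρ : ℕ → Row n) m v → update ρ m v m ≋ v
  update-hit ρ m v with m ℕ.≟ m
  ... | yes _ = ≋-refl
  ... | no m≢m = contradiction ≡.refl m≢m

  update-miss : ∀ {n} (ρ : ℕ → Row n) m v i → i ≢ m → update ρ m v i ≋ ρ i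
  update-miss ρ m v i i≢m with i ℕ.≟ m
  ... | yes i≡m = contradiction i≡m i≢m
  ... | no _ = ≋-refl

  det-add-previous-row : ∀ n m (ρ ρ′ : ℕ → Row n) → suc m < n →
    (∀ i → i ≢ suc m → ρ′ i ≋ ρ i) → (∀ j → ρ (suc m) j ≈ ρ m j + ρ′ (suc m) j) →
    det R n (rows ρ) ≈ det R n (rows ρ′)
  det-add-previous-row n m ρ ρ′ 1+m<n ρ′≋ρ ρₘ₊₁≈ = begin
      det R n (rows ρ)                       ≈⟨ det-row-+ n (suc m) ρ ρ₁ ρ′ 1+m<n (update-miss ρ (suc m) (ρ m)) ρ′≋ρ split ⟩
      det R n (rows ρ₁) + det R n (rows ρ′)  ≈⟨ +-congʳ (det-adjacent-equal-rows n m ρ₁ 1+m<n repeated) ⟩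
      0# + det R n (rows ρ′)                 ≈⟨ +-identityˡ _ ⟩
      det R n (rows ρ′)                      ∎
    where
    ρ₁ = update ρ (suc m) (ρ m)
    split : ∀ j → ρ (suc m) j ≈ ρ₁ (suc m) j + ρ′ (suc m) j
    split j = trans (ρₘ₊₁≈ j) (+-congʳ (sym (update-hit ρ (suc m) (ρ m) j)))
    repeated : ρ₁ m ≋ ρ₁ (suc m)
    repeated = ≋-trans (update-miss ρ (suc m) (ρ m) m (ℕP.1+n≢n ∘ ≡.sym)) (≋-sym (update-hit ρ (suc m) (ρ m)))

  module PascalRows (n : ℕ) (W : ℕ → ℕ → Row n)
                    (W-pascal : ∀ e s j → W (suc e) s j ≈ W e s j + W e (suc s) j) where

    -- The rows after t rounds of bottom-up differencing: W 0 i for i < t, W (i ∸ t) t below.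
    stage : ℕ → ℕ → Row n
    stage t i = W (i ∸ t) (i ⊓ t)

    stage-≤ : ∀ {t i} → i ≤ t → stage t i ≋ W 0 i
    stage-≤ {t} {i} i≤t = ≋-reflexive (≡.cong₂ W (ℕP.m≤n⇒m∸n≡0 i≤t) (ℕP.m≤n⇒m⊓n≡m i≤t))

    stage-≥ : ∀ {t i} → t ≤ i → stage t i ≋ W (i ∸ t) t
    stage-≥ {t} {i} t≤i = ≋-reflexive (≡.cong (W (i ∸ t)) (ℕP.m≥n⇒m⊓n≡n t≤i))

    -- Round t of differencing, carried out so far on the rows below row m.
    partial : ℕ → ℕ → ℕ → Row n
    partial t m i with i ℕ.≤? m
    ... | yes _ = stage t i
    ... | no _ = stage (suc t) i

    partial-≤ : ∀ {t m i} → i ≤ m → partial t m i ≋ stage t i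
    partial-≤ {t} {m} {i} i≤m with i ℕ.≤? m
    ... | yes _ = ≋-refl
    ... | no i≰m = contradiction i≤m i≰m

    partial-> : ∀ {t m i} → m < i → partial t m i ≋ stage (suc t) i
    partial-> {t} {m} {i} m<i with i ℕ.≤? m
    ... | yes i≤m = contradiction i≤m (ℕP.<⇒≱ m<i)
    ... | no _ = ≋-refl

    det-partial-step : ∀ t m → t ≤ m → suc m < n →
      det R n (rows (partial t (suc m))) ≈ det R n (rows (partial t m))
    det-partial-step t m t≤m 1+m<n = det-add-previous-row n m (partial t (suc m)) (partial t m) 1+m<n agree split
      where
      agree : ∀ i → i ≢ suc m → partial t m i ≋ partial t (suc m) i
      agree i i≢1+m with ℕP.≤-<-connex i m
      ... | inj₁ i≤m = ≋-trans (partial-≤ i≤m) (≋-sym (partial-≤ (ℕP.m≤n⇒m≤1+n i≤m)))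
      ... | inj₂ m<i = ≋-trans (partial-> m<i) (≋-sym (partial-> (ℕP.≤∧≢⇒< m<i (i≢1+m ∘ ≡.sym))))
      split : ∀ j → partial t (suc m) (suc m) j ≈ partial t (suc m) m j + partial t m (suc m) j
      split j = begin
        partial t (suc m) (suc m) j        ≈⟨ partial-≤ ℕP.≤-refl j ⟩
        stage t (suc m) j                  ≈⟨ stage-≥ (ℕP.m≤n⇒m≤1+n t≤m) j ⟩
        W (suc m ∸ t) t j                  ≡⟨ ≡.cong (λ e → W e t j) (ℕP.+-∸-assoc 1 t≤m) ⟩
        W (suc (m ∸ t)) t j                ≈⟨ W-pascal (m ∸ t) t j ⟩
        W (m ∸ t) t j + W (m ∸ t) (suc t) j ≈⟨ +-cong (sym (stage-≥ t≤m j)) (sym (stage-≥ (s≤s t≤m) j)) ⟩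
        stage t m j + stage (suc t) (suc m) j ≈⟨ +-cong (sym (partial-≤ (ℕP.n≤1+n m) j)) (sym (partial-> ℕP.≤-refl j)) ⟩
        partial t (suc m) m j + partial t m (suc m) j ∎

    det-partial : ∀ t m → t ≤ m → m < n → det R n (rows (partial t m)) ≈ det R n (rows (partial t t))
    det-partial t zero z≤n _ = refl
    det-partial t (suc m) t≤1+m 1+m<n with ℕP.≤-<-connex t m
    ... | inj₁ t≤m = trans (det-partial-step t m t≤m 1+m<n) (det-partial t m t≤m (ℕP.<-trans (ℕP.n<1+n m) 1+m<n))
    ... | inj₂ m<t = reflexive (≡.cong (λ u → det R n (rows (partial t u))) (ℕP.≤-antisym m<t t≤1+m))

    det-stage-suc : ∀ t → t < n → det R n (rows (stage t)) ≈ det R n (rows (stage (suc t)))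
    det-stage-suc t t<n = begin
        det R n (rows (stage t))               ≈⟨ det-cong n (λ i → ≋-sym (partial-≤ (ℕP.<⇒≤pred (toℕ<n i)))) ⟩
        det R n (rows (partial t (ℕ.pred n)))  ≈⟨ det-partial t (ℕ.pred n) (ℕP.<⇒≤pred t<n) (pred<self t<n) ⟩
        det R n (rows (partial t t))           ≈⟨ det-cong n (λ i → finished (toℕ i)) ⟩
        det R n (rows (stage (suc t)))         ∎
      where
      pred<self : ∀ {t n} → t < n → ℕ.pred n < n
      pred<self (s≤s _) = ℕP.n<1+n _
      finished : ∀ i → partial t t i ≋ stage (suc t) i
      finished i with ℕP.≤-<-connex i t
      ... | inj₁ i≤t = ≋-trans (partial-≤ i≤t) (≋-trans (stage-≤ i≤t) (≋-sym (stage-≤ (ℕP.m≤n⇒m≤1+n i≤t))))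
      ... | inj₂ t<i = partial-> t<i

    det-stage : ∀ t → t ≤ n → det R n (rows (stage 0)) ≈ det R n (rows (stage t))
    det-stage zero _ = refl
    det-stage (suc t) t<n = trans (det-stage t (ℕP.<⇒≤ t<n)) (det-stage-suc t t<n)

    det-pascal-rows : det R n (rows (λ i → W i 0)) ≈ det R n (rows (λ i → W 0 i))
    det-pascal-rows = begin
      det R n (rows (λ i → W i 0))   ≈⟨ det-cong n (λ i → ≋-sym (stage-≥ z≤n)) ⟩
      det R n (rows (stage 0))       ≈⟨ det-stage n ℕP.≤-refl ⟩
      det R n (rows (stage n))       ≈⟨ det-cong n (λ i → stage-≤ (ℕP.<⇒≤ (toℕ<n i))) ⟩
      det R n (rows (λ i → W 0 i))   ∎

  module HessenbergToeplitz (τ : ℕ → ℕ → Carrier)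
                            (τ-shift : ∀ i j → τ (suc i) (suc j) ≈ τ i j)
                            (τ-subdiagonal : τ 1 0 ≈ 1#)
                            (τ-below : ∀ i → τ (suc (suc i)) 0 ≈ 0#) where

    D : ℕ → Carrier
    D n = det R n (λ i j → τ (toℕ i) (toℕ j))

    -- The minor of column j is block triangular with j ones on the diagonal.
    det-minor : ∀ n (j : Fin (suc n)) → det R n (minor (λ i j → τ (toℕ i) (toℕ j)) j) ≈ D (n ∸ toℕ j)
    det-minor n zero = det-cong n (λ i l → τ-shift _ _)
    det-minor (suc n) (suc j) =
      trans (+-cong first (laplaceTerms-suc≈0 n M (λ i → τ-below (toℕ i)))) (+-identityʳ _)
      where
      M : Matrix (suc n)
      M = minor (λ i j → τ (toℕ i) (toℕ j)) (suc j)
      first : laplaceTerm n M zero ≈ D (n ∸ toℕ j)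
      first = trans (*-identityˡ _) (trans (*-cong τ-subdiagonal (trans (det-cong n (λ i l → τ-shift _ _)) (det-minor n j))) (*-identityˡ _))

    D-expansion : ∀ n → D (suc n) ≈ sumFin R (suc n) (λ j → sign R (toℕ j) * (τ 0 (toℕ j) * D (n ∸ toℕ j)))
    D-expansion n = sumFin-cong (suc n) {laplaceTerm n (λ i j → τ (toℕ i) (toℕ j))} (λ j → *-congˡ (*-congˡ (det-minor n j)))

  -- Sequences ℕ → Carrier are read as formal power series in t: conv n a d is the
  -- coefficient of tⁿ in a · d, shift multiplies by t and Δ by 1 − t.
  Seq : Set c
  Seq = ℕ → Carrier

  _≗_ : Seq → Seq → Set ℓ
  a ≗ b = ∀ m → a m ≈ b m
  infix 4 _≗_

  conv : ℕ → Seq → Seq → Carrier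
  conv zero a d = a 0 * d 0
  conv (suc n) a d = a 0 * d (suc n) + conv n (a ∘ suc) d

  shift : Seq → Seq
  shift d zero = 0#
  shift d (suc m) = d m

  Δ : Seq → Seq
  Δ d m = d m - shift d m

  Δ^ : ℕ → Seq → Seq
  Δ^ zero d = d
  Δ^ (suc k) d = Δ (Δ^ k d)

  δ : Seq
  δ zero = 1#
  δ (suc m) = 0#

  conv-sumFin : ∀ n a d → conv n a d ≈ sumFin R (suc n) (λ j → a (toℕ j) * d (n ∸ toℕ j))
  conv-sumFin zero a d = sym (+-identityʳ _)
  conv-sumFin (suc n) a d = +-congˡ (conv-sumFin n (a ∘ suc) d)

  conv-cong : ∀ n {a a′ d d′} → a ≗ a′ → d ≗ d′ → conv n a d ≈ conv n a′ d′
  conv-cong zero a≗a′ d≗d′ = *-cong (a≗a′ 0) (d≗d′ 0)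
  conv-cong (suc n) a≗a′ d≗d′ = +-cong (*-cong (a≗a′ 0) (d≗d′ (suc n))) (conv-cong n (a≗a′ ∘ suc) d≗d′)

  conv-congʳ-≤ : ∀ n a {d d′} → (∀ m → m ≤ n → d m ≈ d′ m) → conv n a d ≈ conv n a d′
  conv-congʳ-≤ zero a d≈d′ = *-congˡ (d≈d′ 0 z≤n)
  conv-congʳ-≤ (suc n) a d≈d′ =
    +-cong (*-congˡ (d≈d′ (suc n) ℕP.≤-refl)) (conv-congʳ-≤ n _ (λ m m≤n → d≈d′ m (ℕP.m≤n⇒m≤1+n m≤n)))

  conv-+ˡ : ∀ n a a′ d → conv n (λ m → a m + a′ m) d ≈ conv n a d + conv n a′ d
  conv-+ˡ zero a a′ d = distribʳ _ _ _
  conv-+ˡ (suc n) a a′ d = trans (+-cong (distribʳ _ _ _) (conv-+ˡ n _ _ d)) (interchange _ _ _ _)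
    where
    interchange : ∀ p q r s → (p + q) + (r + s) ≈ (p + r) + (q + s)
    interchange = solve 4 (λ p q r s → (p :+ q) :+ (r :+ s) := (p :+ r) :+ (q :+ s)) refl

  conv-+ʳ : ∀ n a d d′ → conv n a (λ m → d m + d′ m) ≈ conv n a d + conv n a d′
  conv-+ʳ zero a d d′ = distribˡ _ _ _
  conv-+ʳ (suc n) a d d′ = trans (+-cong (distribˡ _ _ _) (conv-+ʳ n _ d d′)) (interchange _ _ _ _)
    where
    interchange : ∀ p q r s → (p + q) + (r + s) ≈ (p + r) + (q + s)
    interchange = solve 4 (λ p q r s → (p :+ q) :+ (r :+ s) := (p :+ r) :+ (q :+ s)) refl

  conv-negˡ : ∀ n a d → conv n (λ m → - a m) d ≈ - conv n a d
  conv-negˡ zero a d = sym (-‿distribˡ-* _ _)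
  conv-negˡ (suc n) a d = trans (+-cong (sym (-‿distribˡ-* _ _)) (conv-negˡ n _ d)) (-‿+-comm _ _)

  conv-negʳ : ∀ n a d → conv n a (λ m → - d m) ≈ - conv n a d
  conv-negʳ zero a d = sym (-‿distribʳ-* _ _)
  conv-negʳ (suc n) a d = trans (+-cong (sym (-‿distribʳ-* _ _)) (conv-negʳ n _ d)) (-‿+-comm _ _)

  conv-*ˡ : ∀ n x a d → conv n (λ m → x * a m) d ≈ x * conv n a d
  conv-*ˡ zero x a d = *-assoc _ _ _
  conv-*ˡ (suc n) x a d = trans (+-cong (*-assoc _ _ _) (conv-*ˡ n x _ d)) (sym (distribˡ _ _ _))

  conv-shiftˡ : ∀ n a d → conv (suc n) (shift a) d ≈ conv n a d
  conv-shiftˡ n a d = trans (+-congʳ (zeroˡ _)) (+-identityˡ _)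

  conv-shiftʳ : ∀ n a d → conv (suc n) a (shift d) ≈ conv n a d
  conv-shiftʳ zero a d = trans (+-congˡ (zeroʳ _)) (+-identityʳ _)
  conv-shiftʳ (suc n) a d = +-congˡ (conv-shiftʳ n _ d)

  conv-shift : ∀ n a d → conv n (shift a) d ≈ conv n a (shift d)
  conv-shift zero a d = trans (zeroˡ _) (sym (zeroʳ _))
  conv-shift (suc n) a d = trans (conv-shiftˡ n a d) (sym (conv-shiftʳ n a d))

  conv-Δ : ∀ n a d → conv n (Δ a) d ≈ conv n a (Δ d)
  conv-Δ n a d = begin
    conv n (λ m → a m - shift a m) d               ≈⟨ conv-+ˡ n a (λ m → - shift a m) d ⟩
    conv n a d + conv n (λ m → - shift a m) d      ≈⟨ +-congˡ (trans (conv-negˡ n (shift a) d) (-‿cong (conv-shift n a d))) ⟩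
    conv n a d - conv n a (shift d)                ≈⟨ +-congˡ (sym (conv-negʳ n a (shift d))) ⟩
    conv n a d + conv n a (λ m → - shift d m)      ≈⟨ sym (conv-+ʳ n a d (λ m → - shift d m)) ⟩
    conv n a (λ m → d m - shift d m)               ∎

  Δ-cong : ∀ {a b} → a ≗ b → Δ a ≗ Δ b
  Δ-cong a≗b zero = +-cong (a≗b 0) refl
  Δ-cong a≗b (suc m) = +-cong (a≗b (suc m)) (-‿cong (a≗b m))

  Δ^-cong : ∀ k {a b} → a ≗ b → Δ^ k a ≗ Δ^ k b
  Δ^-cong zero a≗b = a≗b
  Δ^-cong (suc k) a≗b = Δ-cong (Δ^-cong k a≗b)

  conv-Δ^ : ∀ k n a d → conv n (Δ^ k a) d ≈ conv n a (Δ^ k d)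
  conv-Δ^ zero n a d = refl
  conv-Δ^ (suc k) n a d = trans (conv-Δ n (Δ^ k a) d) (trans (conv-Δ^ k n a (Δ d)) (conv-cong n (λ _ → refl) (Δ^-Δ k d)))
    where
    Δ^-Δ : ∀ k d → Δ^ k (Δ d) ≗ Δ (Δ^ k d)
    Δ^-Δ zero d m = refl
    Δ^-Δ (suc k) d = Δ-cong (Δ^-Δ k d)

  conv-δ : ∀ n d → conv n δ d ≈ d n
  conv-δ zero d = *-identityˡ _
  conv-δ (suc n) d = trans (+-congˡ (tail≈0 n d)) (trans (+-identityʳ _) (*-identityˡ _))
    where
    tail≈0 : ∀ n d → conv n (δ ∘ suc) d ≈ 0#
    tail≈0 zero d = zeroˡ _
    tail≈0 (suc n) d = trans (+-cong (zeroˡ _) (tail≈0 n d)) (+-identityʳ 0#)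

  -- A series with constant term 1 is cancellable, by solving for the coefficients in turn.
  conv-cancelˡ : ∀ a d d′ → a 0 ≈ 1# → (∀ n → conv n a d ≈ conv n a d′) → d ≗ d′
  conv-cancelˡ a d d′ a₀≈1 ad≈ad′ n = upTo n n ℕP.≤-refl
    where
    a₀-cancel : ∀ {m} → a 0 * d m ≈ a 0 * d′ m → d m ≈ d′ m
    a₀-cancel {m} eq = begin
      d m          ≈⟨ sym (*-identityˡ _) ⟩
      1# * d m     ≈⟨ *-congʳ (sym a₀≈1) ⟩
      a 0 * d m    ≈⟨ eq ⟩
      a 0 * d′ m   ≈⟨ *-congʳ a₀≈1 ⟩
      1# * d′ m    ≈⟨ *-identityˡ _ ⟩
      d′ m         ∎
    cancelʳ : ∀ {p q r s} → p + r ≈ q + s → r ≈ s → p ≈ q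
    cancelʳ {p} {q} {r} {s} eq r≈s = begin
      p              ≈⟨ solve 2 (λ p r → p := (p :+ r) :- r) refl p r ⟩
      (p + r) - r    ≈⟨ +-cong eq (-‿cong r≈s) ⟩
      (q + s) - s    ≈⟨ solve 2 (λ q s → (q :+ s) :- s := q) refl q s ⟩
      q              ∎
    upTo : ∀ n m → m ≤ n → d m ≈ d′ m
    upTo zero .zero z≤n = a₀-cancel (ad≈ad′ 0)
    upTo (suc n) m m≤1+n with ℕP.m≤n⇒m<n∨m≡n m≤1+n
    ... | inj₁ (s≤s m≤n) = upTo n m m≤n
    ... | inj₂ ≡.refl = a₀-cancel (cancelʳ (ad≈ad′ (suc n)) (conv-congʳ-≤ n (a ∘ suc) (λ k k≤n → upTo n k k≤n)))

  -- If v′ = (1 − t) v, then 1 / v′ is the sequence of partial sums of 1 / v.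
  inverse-Δ : ∀ v v′ D D′ → v′ ≗ Δ v → v′ 0 ≈ 1# → (∀ n → conv n v D ≈ δ n) → (∀ n → conv n v′ D′ ≈ δ n) →
    ∀ n → D′ (suc n) ≈ D (suc n) + D′ n
  inverse-Δ v v′ D D′ v′≗Δv v′₀≈1 vD≈δ v′D′≈δ n = begin
      D′ (suc n)               ≈⟨ sym (Σ≗D′ (suc n)) ⟩
      Σ n + D (suc n)          ≈⟨ +-cong (Σ≗D′ n) refl ⟩
      D′ n + D (suc n)         ≈⟨ +-comm _ _ ⟩
      D (suc n) + D′ n         ∎
    where
    Σ : Seq
    Σ zero = D 0
    Σ (suc m) = Σ m + D (suc m)
    ΔΣ≗D : Δ Σ ≗ D
    ΔΣ≗D zero = trans (+-congˡ -0#≈0#) (+-identityʳ _)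
    ΔΣ≗D (suc m) = solve 2 (λ p q → (p :+ q) :- p := q) refl (Σ m) (D (suc m))
    Σ≗D′ : Σ ≗ D′
    Σ≗D′ = conv-cancelˡ v′ Σ D′ v′₀≈1 (λ n → begin
      conv n v′ Σ        ≈⟨ conv-cong n v′≗Δv (λ _ → refl) ⟩
      conv n (Δ v) Σ     ≈⟨ conv-Δ n v Σ ⟩
      conv n v (Δ Σ)     ≈⟨ conv-cong n (λ _ → refl) ΔΣ≗D ⟩
      conv n v D         ≈⟨ vD≈δ n ⟩
      δ n                ≈⟨ sym (v′D′≈δ n) ⟩
      conv n v′ D′       ∎)

  -- If v = (1 − t)ᵏ − X t, then (1 − t)ᵏ / v = 1 + X t / v.
  inverse-Δ^-shift : ∀ k v D D₀ X → v ≗ (λ m → Δ^ k δ m - X * shift δ m) → (∀ n → conv n v D ≈ δ n) → D₀ ≗ Δ^ k D →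
    ∀ n → D₀ (suc n) ≈ X * D n
  inverse-Δ^-shift k v D D₀ X v≗ vD≈δ D₀≗ n = x-y≈0⇒x≈y (begin
      D₀ (suc n) - X * D n
    ≈⟨ +-cong (D₀≗ (suc n)) (-‿cong (*-congˡ (sym (conv-δ n D)))) ⟩
      Δ^ k D (suc n) - X * conv n δ D
    ≈⟨ +-cong (sym (conv-δ (suc n) (Δ^ k D))) (-‿cong (*-congˡ (sym (conv-shiftˡ n δ D)))) ⟩
      conv (suc n) δ (Δ^ k D) - X * conv (suc n) (shift δ) D
    ≈⟨ +-cong (sym (conv-Δ^ k (suc n) δ D)) (sym (trans (conv-negˡ (suc n) (λ m → X * shift δ m) D) (-‿cong (conv-*ˡ (suc n) X (shift δ) D)))) ⟩
      conv (suc n) (Δ^ k δ) D + conv (suc n) (λ m → - (X * shift δ m)) D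
    ≈⟨ sym (conv-+ˡ (suc n) (Δ^ k δ) (λ m → - (X * shift δ m)) D) ⟩
      conv (suc n) (λ m → Δ^ k δ m - X * shift δ m) D
    ≈⟨ sym (conv-cong (suc n) v≗ (λ _ → refl)) ⟩
      conv (suc n) v D
    ≈⟨ vD≈δ (suc n) ⟩
      0#
    ∎)
    where
    x-y≈0⇒x≈y : ∀ {x y} → x - y ≈ 0# → x ≈ y
    x-y≈0⇒x≈y {x} {y} x-y≈0 = trans (solve 2 (λ x y → x := (x :- y) :+ y) refl x y) (trans (+-congʳ x-y≈0) (+-identityˡ y))

  pow-+ : ∀ y a b → pow R y (a ℕ.+ b) ≈ pow R y a * pow R y b
  pow-+ y zero b = sym (*-identityˡ _)
  pow-+ y (suc a) b = trans (*-congˡ (pow-+ y a b)) (sym (*-assoc _ _ _))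

  pow-* : ∀ y a b → pow R y (a ℕ.* b) ≈ pow R (pow R y a) b
  pow-* y a zero = reflexive (≡.cong (pow R y) (ℕP.*-zeroʳ a))
  pow-* y a (suc b) = begin
    pow R y (a ℕ.* suc b)                ≡⟨ ≡.cong (pow R y) (ℕP.*-suc a b) ⟩
    pow R y (a ℕ.+ a ℕ.* b)              ≈⟨ pow-+ y a (a ℕ.* b) ⟩
    pow R y a * pow R y (a ℕ.* b)        ≈⟨ *-congˡ (pow-* y a b) ⟩
    pow R y a * pow R (pow R y a) b      ∎

  sumTo-cong-≤ : ∀ n (f g : ℕ → Carrier) → (∀ m → m ≤ n → f m ≈ g m) → sumTo R n f ≈ sumTo R n g
  sumTo-cong-≤ zero f g f≈g = f≈g 0 z≤n
  sumTo-cong-≤ (suc n) f g f≈g = +-cong (sumTo-cong-≤ n f g (λ m m≤n → f≈g m (ℕP.m≤n⇒m≤1+n m≤n))) (f≈g (suc n) ℕP.≤-refl)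

  sumTo-*ˡ : ∀ n a (f : ℕ → Carrier) → sumTo R n (λ m → a * f m) ≈ a * sumTo R n f
  sumTo-*ˡ zero a f = refl
  sumTo-*ˡ (suc n) a f = trans (+-congʳ (sumTo-*ˡ n a f)) (sym (distribˡ _ _ _))

  antidiagonal : ℕ → (ℕ → ℕ → Carrier) → Carrier
  antidiagonal zero g = g 0 0
  antidiagonal (suc n) g = g 0 (suc n) + antidiagonal n (λ i m → g (suc i) m)

  antidiagonal-cong : ∀ n {g h : ℕ → ℕ → Carrier} → (∀ i m → g i m ≈ h i m) → antidiagonal n g ≈ antidiagonal n h
  antidiagonal-cong zero g≈h = g≈h 0 0
  antidiagonal-cong (suc n) g≈h = +-cong (g≈h 0 (suc n)) (antidiagonal-cong n (λ i m → g≈h (suc i) m))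

  antidiagonal-+ : ∀ n (g h : ℕ → ℕ → Carrier) → antidiagonal n (λ i m → g i m + h i m) ≈ antidiagonal n g + antidiagonal n h
  antidiagonal-+ zero g h = refl
  antidiagonal-+ (suc n) g h = trans (+-congˡ (antidiagonal-+ n _ _)) (interchange _ _ _ _)
    where
    interchange : ∀ p q r s → (p + q) + (r + s) ≈ (p + r) + (q + s)
    interchange = solve 4 (λ p q r s → (p :+ q) :+ (r :+ s) := (p :+ r) :+ (q :+ s)) refl

  antidiagonal-*ˡ : ∀ n a (g : ℕ → ℕ → Carrier) → antidiagonal n (λ i m → a * g i m) ≈ a * antidiagonal n g
  antidiagonal-*ˡ zero a g = refl
  antidiagonal-*ˡ (suc n) a g = trans (+-congˡ (antidiagonal-*ˡ n a _)) (sym (distribˡ _ _ _))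

  antidiagonal-suc : ∀ n (g : ℕ → ℕ → Carrier) → antidiagonal (suc n) g ≈ g (suc n) 0 + antidiagonal n (λ i m → g i (suc m))
  antidiagonal-suc zero g = +-comm _ _
  antidiagonal-suc (suc n) g = trans (+-congˡ (antidiagonal-suc n (λ i m → g (suc i) m))) (swap _ _ _)
    where
    swap : ∀ a b c → a + (b + c) ≈ b + (a + c)
    swap = solve 3 (λ a b c → a :+ (b :+ c) := b :+ (a :+ c)) refl

  antidiagonal≈sumTo : ∀ n g → antidiagonal n g ≈ sumTo R n (λ m → g (n ∸ m) m)
  antidiagonal≈sumTo zero g = refl
  antidiagonal≈sumTo (suc n) g = begin
      g 0 (suc n) + antidiagonal n (λ i m → g (suc i) m)   ≈⟨ +-congˡ (antidiagonal≈sumTo n (λ i m → g (suc i) m)) ⟩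
      g 0 (suc n) + sumTo R n (λ m → g (suc (n ∸ m)) m)    ≈⟨ +-comm _ _ ⟩
      sumTo R n (λ m → g (suc (n ∸ m)) m) + g 0 (suc n)
        ≈⟨ +-cong (sumTo-cong-≤ n _ _ (λ m m≤n → reflexive (≡.cong (λ i → g i m) (≡.sym (ℕP.+-∸-assoc 1 m≤n)))))
                  (reflexive (≡.cong (λ i → g i (suc n)) (≡.sym (ℕP.n∸n≡0 n)))) ⟩
      sumTo R n (λ m → g (suc n ∸ m) m) + g (n ∸ n) (suc n) ∎

  module _ (x : Carrier) (k′ : ℕ) where

    k : ℕ
    k = suc k′

    X : Carrier
    X = pow R x k

    -- entry b is a Toeplitz upper Hessenberg matrix, and row i of A_n(k, r, x) is entry (r + 1 + i) 0.
    entry : ℤ → ℕ → ℕ → Carrier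
    entry b s j = intR R (binomialSub (b ℤ.- + k) j s) * X + intR R (binomialSub b (suc j) s)

    entry-subdiagonal : ∀ b → entry b 1 0 ≈ 1#
    entry-subdiagonal b = trans (+-cong (zeroˡ X) (+-identityʳ 1#)) (+-identityˡ 1#)

    entry-below : ∀ b i → entry b (suc (suc i)) 0 ≈ 0#
    entry-below b i = trans (+-congʳ (zeroˡ X)) (+-identityˡ 0#)

    entry-pascal : ∀ b s j → entry (ℤ.suc b) s j ≈ entry b s j + entry b (suc s) j
    entry-pascal b s j = begin
        intR R (binomialSub (ℤ.suc b ℤ.- + k) j s) * X + intR R (binomialSub (ℤ.suc b) (suc j) s)
      ≡⟨ ≡.cong (λ a → intR R (binomialSub a j s) * X + intR R (binomialSub (ℤ.suc b) (suc j) s)) (ℤP.+-assoc (+ 1) b (ℤ.- + k)) ⟩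
        intR R (binomialSub (ℤ.suc (b ℤ.- + k)) j s) * X + intR R (binomialSub (ℤ.suc b) (suc j) s)
      ≈⟨ +-cong (*-congʳ (trans (reflexive (≡.cong (intR R) (binomialSub-pascal (b ℤ.- + k) j s)))
                                 (intR-+ (binomialSub (b ℤ.- + k) j s) (binomialSub (b ℤ.- + k) j (suc s)))))
                (trans (reflexive (≡.cong (intR R) (binomialSub-pascal b (suc j) s)))
                       (intR-+ (binomialSub b (suc j) s) (binomialSub b (suc j) (suc s)))) ⟩
        (intR R (binomialSub (b ℤ.- + k) j s) + intR R (binomialSub (b ℤ.- + k) j (suc s))) * X
          + (intR R (binomialSub b (suc j) s) + intR R (binomialSub b (suc j) (suc s)))
      ≈⟨ solve 5 (λ p q X r s → (p :+ q) :* X :+ (r :+ s) := (p :* X :+ r) :+ (q :* X :+ s)) refl _ _ _ _ _ ⟩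
        entry b s j + entry b (suc s) j
      ∎

    D : ℤ → ℕ → Carrier
    D b n = det R n (λ i j → entry b (toℕ i) (toℕ j))

    module Hessenberg (b : ℤ) = HessenbergToeplitz (entry b) (λ _ _ → refl) (entry-subdiagonal b) (entry-below b)

    V : ℤ → Seq
    V b m = sign R m * entry b 1 m

    V-0 : ∀ b → V b 0 ≈ 1#
    V-0 b = trans (*-identityˡ _) (entry-subdiagonal b)

    V*D≈δ : ∀ b n → conv n (V b) (D b) ≈ δ n
    V*D≈δ b zero = trans (*-identityʳ _) (V-0 b)
    V*D≈δ b (suc n) = begin
        V b 0 * D b (suc n) + conv n (V b ∘ suc) (D b)
      ≈⟨ +-cong (trans (*-congʳ (V-0 b)) (*-identityˡ _)) (conv-sumFin n (V b ∘ suc) (D b)) ⟩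
        D b (suc n) + sumFin R (suc n) (λ j → V b (suc (toℕ j)) * D b (n ∸ toℕ j))
      ≈⟨ +-congˡ (sumFin-cong (suc n) {λ j → V b (suc (toℕ j)) * D b (n ∸ toℕ j)} {λ j → - term j}
           (λ j → solve 3 (λ s t d → ((:- s) :* t) :* d := :- (s :* (t :* d))) refl (sign R (toℕ j)) (entry b 0 (toℕ j)) (D b (n ∸ toℕ j)))) ⟩
        D b (suc n) + sumFin R (suc n) (λ j → - term j)
      ≈⟨ +-congˡ (trans (sumFin-neg (suc n) term) (-‿cong (sym (Hessenberg.D-expansion b n)))) ⟩
        D b (suc n) - D b (suc n)
      ≈⟨ -‿inverseʳ _ ⟩
        0#
      ∎
      where
      term : Fin (suc n) → Carrier
      term j = sign R (toℕ j) * (entry b 0 (toℕ j) * D b (n ∸ toℕ j))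

    V-suc : ∀ b → V (ℤ.suc b) ≗ Δ (V b)
    V-suc b m = begin
      sign R m * entry (ℤ.suc b) 1 m                  ≈⟨ *-congˡ (entry-pascal b 1 m) ⟩
      sign R m * (entry b 1 m + entry b 2 m)          ≈⟨ distribˡ _ _ _ ⟩
      V b m + sign R m * entry b 2 m                  ≈⟨ +-congˡ (shifted m) ⟩
      V b m - shift (V b) m                           ∎
      where
      shifted : ∀ m → sign R m * entry b 2 m ≈ - shift (V b) m
      shifted zero = trans (*-congˡ (entry-below b 0)) (trans (zeroʳ _) (sym -0#≈0#))
      shifted (suc m) = sym (-‿distribˡ-* _ _)

    Δ^δ≈signed-binomial : ∀ j m → Δ^ j δ m ≈ sign R m * intR R (binomial (+ j) m)
    Δ^δ≈signed-binomial zero zero = sym (trans (*-identityˡ _) (+-identityʳ 1#))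
    Δ^δ≈signed-binomial zero (suc m) = sym (zeroʳ _)
    Δ^δ≈signed-binomial (suc j) zero = trans (+-congˡ -0#≈0#) (trans (+-identityʳ _) (Δ^δ≈signed-binomial j zero))
    Δ^δ≈signed-binomial (suc j) (suc m) = begin
        Δ^ j δ (suc m) - Δ^ j δ m
      ≈⟨ +-cong (Δ^δ≈signed-binomial j (suc m)) (-‿cong (Δ^δ≈signed-binomial j m)) ⟩
        (- sign R m) * intR R (binomial (+ j) (suc m)) - sign R m * intR R (binomial (+ j) m)
      ≈⟨ solve 3 (λ s p q → (:- s) :* p :- s :* q := (:- s) :* (p :+ q)) refl (sign R m) _ _ ⟩
        (- sign R m) * (intR R (binomial (+ j) (suc m)) + intR R (binomial (+ j) m))
      ≈⟨ *-congˡ (sym (intR-+ (binomial (+ j) (suc m)) (binomial (+ j) m))) ⟩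
        (- sign R m) * intR R (binomial (+ suc j) (suc m))
      ∎

    V-k : V (+ k) ≗ (λ m → Δ^ k δ m - X * shift δ m)
    V-k m = begin
        sign R m * (intR R (binomialSub (+ k ℤ.- + k) m 1) * X + intR R (binomial (+ k) m))
      ≡⟨ ≡.cong (λ a → sign R m * (intR R (binomialSub a m 1) * X + intR R (binomial (+ k) m))) (ℤP.+-inverseʳ (+ k)) ⟩
        sign R m * (intR R (binomialSub (+ 0) m 1) * X + intR R (binomial (+ k) m))
      ≈⟨ expand (sign R m) (intR R (binomialSub (+ 0) m 1)) X (intR R (binomial (+ k) m)) (shift δ m) (sign*coefficient m) ⟩
        sign R m * intR R (binomial (+ k) m) - X * shift δ m
      ≈⟨ +-congʳ (sym (Δ^δ≈signed-binomial k m)) ⟩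
        Δ^ k δ m - X * shift δ m
      ∎
      where
      sign*coefficient : ∀ m → sign R m * intR R (binomialSub (+ 0) m 1) ≈ - shift δ m
      sign*coefficient zero = trans (zeroʳ _) (sym -0#≈0#)
      sign*coefficient (suc zero) = trans (*-congˡ (+-identityʳ 1#)) (*-identityʳ _)
      sign*coefficient (suc (suc m)) = trans (zeroʳ _) (sym -0#≈0#)
      expand : ∀ s c X B e → s * c ≈ - e → s * (c * X + B) ≈ s * B - X * e
      expand s c X B e sc≈-e = begin
        s * (c * X + B)       ≈⟨ solve 4 (λ s c X B → s :* (c :* X :+ B) := (s :* c) :* X :+ s :* B) refl s c X B ⟩
        (s * c) * X + s * B   ≈⟨ +-congʳ (*-congʳ sc≈-e) ⟩
        (- e) * X + s * B     ≈⟨ solve 4 (λ e X s B → (:- e) :* X :+ s :* B := s :* B :- X :* e) refl e X s B ⟩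
        s * B - X * e         ∎

    D-suc : ∀ b n → D (ℤ.suc b) (suc n) ≈ D b (suc n) + D (ℤ.suc b) n
    D-suc b = inverse-Δ (V b) (V (ℤ.suc b)) (D b) (D (ℤ.suc b)) (V-suc b) (V-0 (ℤ.suc b)) (V*D≈δ b) (V*D≈δ (ℤ.suc b))

    D≗ΔD : ∀ j → D (+ j) ≗ Δ (D (+ suc j))
    D≗ΔD j zero = sym (trans (+-congˡ -0#≈0#) (+-identityʳ _))
    D≗ΔD j (suc n) = begin
      D (+ j) (suc n)                                       ≈⟨ solve 2 (λ p q → p := (p :+ q) :- q) refl _ _ ⟩
      (D (+ j) (suc n) + D (+ suc j) n) - D (+ suc j) n     ≈⟨ +-congʳ (sym (D-suc (+ j) n)) ⟩
      D (+ suc j) (suc n) - D (+ suc j) n                   ∎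

    D≗Δ^D : ∀ i j → D (+ j) ≗ Δ^ i (D (+ (i ℕ.+ j)))
    D≗Δ^D zero j m = refl
    D≗Δ^D (suc i) j m = trans (D≗ΔD j m) (Δ-cong (λ m′ → trans (D≗Δ^D i (suc j) m′)
      (Δ^-cong i (λ m″ → reflexive (≡.cong (λ t → D (+ t) m″) (ℕP.+-suc i j))) m′)) m)

    D₀-suc : ∀ n → D (+ 0) (suc n) ≈ X * D (+ k) n
    D₀-suc = inverse-Δ^-shift k (V (+ k)) (D (+ k)) (D (+ 0)) X V-k (V*D≈δ (+ k))
      (λ m → trans (D≗Δ^D k 0 m) (Δ^-cong k (λ m′ → reflexive (≡.cong (λ t → D (+ t) m′) (ℕP.+-identityʳ k))) m))

    Ψ : ℕ → ℕ → Carrier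
    Ψ r n = antidiagonal n (λ i m → intR R (binomial (+ (m ℕ.+ r ℕ.+ k ℕ.* i)) m) * pow R X i)

    Ψ-suc : ∀ r n → Ψ (suc r) (suc n) ≈ Ψ r (suc n) + Ψ (suc r) n
    Ψ-suc r n = begin
        antidiagonal (suc n) f
      ≈⟨ antidiagonal-suc n f ⟩
        f (suc n) 0 + antidiagonal n (λ i m → f i (suc m))
      ≈⟨ +-congˡ (antidiagonal-cong n {λ i m → f i (suc m)} {λ i m → f′ i (suc m) + f i m} split) ⟩
        f (suc n) 0 + antidiagonal n (λ i m → f′ i (suc m) + f i m)
      ≈⟨ +-congˡ (antidiagonal-+ n _ _) ⟩
        f (suc n) 0 + (antidiagonal n (λ i m → f′ i (suc m)) + antidiagonal n f)
      ≈⟨ sym (+-assoc _ _ _) ⟩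
        (f′ (suc n) 0 + antidiagonal n (λ i m → f′ i (suc m))) + antidiagonal n f
      ≈⟨ +-congʳ (sym (antidiagonal-suc n f′)) ⟩
        Ψ r (suc n) + Ψ (suc r) n
      ∎
      where
      f f′ : ℕ → ℕ → Carrier
      f i m = intR R (binomial (+ (m ℕ.+ suc r ℕ.+ k ℕ.* i)) m) * pow R X i
      f′ i m = intR R (binomial (+ (m ℕ.+ r ℕ.+ k ℕ.* i)) m) * pow R X i
      split : ∀ i m → f i (suc m) ≈ f′ i (suc m) + f i m
      split i m = begin
          intR R (binomial (+ (suc m ℕ.+ suc r ℕ.+ k ℕ.* i)) (suc m)) * pow R X i
        ≈⟨ *-congʳ (intR-+ (binomial (+ (m ℕ.+ suc r ℕ.+ k ℕ.* i)) (suc m)) (binomial (+ (m ℕ.+ suc r ℕ.+ k ℕ.* i)) m)) ⟩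
          (intR R (binomial (+ (m ℕ.+ suc r ℕ.+ k ℕ.* i)) (suc m)) + intR R (binomial (+ (m ℕ.+ suc r ℕ.+ k ℕ.* i)) m)) * pow R X i
        ≈⟨ distribʳ _ _ _ ⟩
          intR R (binomial (+ (m ℕ.+ suc r ℕ.+ k ℕ.* i)) (suc m)) * pow R X i + f i m
        ≡⟨ ≡.cong (λ t → intR R (binomial (+ (t ℕ.+ k ℕ.* i)) (suc m)) * pow R X i + f i m) (ℕP.+-suc m r) ⟩
          f′ i (suc m) + f i m
        ∎

    Ψ₀-suc : ∀ n → Ψ 0 (suc n) ≈ Ψ 0 n + X * Ψ k′ n
    Ψ₀-suc n = begin
        antidiagonal (suc n) f
      ≈⟨ antidiagonal-suc n f ⟩
        f (suc n) 0 + antidiagonal n (λ i m → f i (suc m))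
      ≈⟨ +-congˡ (antidiagonal-cong n {λ i m → f i (suc m)} {λ i m → h i m + f i m}
                    (λ i m → trans (*-congʳ (intR-+ (binomial (+ (m ℕ.+ 0 ℕ.+ k ℕ.* i)) (suc m)) (binomial (+ (m ℕ.+ 0 ℕ.+ k ℕ.* i)) m)))
                                   (distribʳ _ _ _))) ⟩
        f (suc n) 0 + antidiagonal n (λ i m → h i m + f i m)
      ≈⟨ +-congˡ (antidiagonal-+ n h f) ⟩
        f (suc n) 0 + (antidiagonal n h + antidiagonal n f)
      ≈⟨ sym (+-assoc _ _ _) ⟩
        (f (suc n) 0 + antidiagonal n h) + antidiagonal n f
      ≈⟨ +-congʳ (top-row n) ⟩
        X * antidiagonal n g + antidiagonal n f
      ≈⟨ +-comm _ _ ⟩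
        Ψ 0 n + X * Ψ k′ n
      ∎
      where
      f h g : ℕ → ℕ → Carrier
      f i m = intR R (binomial (+ (m ℕ.+ 0 ℕ.+ k ℕ.* i)) m) * pow R X i
      h i m = intR R (binomial (+ (m ℕ.+ 0 ℕ.+ k ℕ.* i)) (suc m)) * pow R X i
      g i m = intR R (binomial (+ (m ℕ.+ k′ ℕ.+ k ℕ.* i)) m) * pow R X i
      index-shift : ∀ m i → m ℕ.+ 0 ℕ.+ k ℕ.* suc i ≡ suc m ℕ.+ k′ ℕ.+ k ℕ.* i
      index-shift m i = shift′ m i k′
        where
        shift′ : ∀ m i k′ → m ℕ.+ 0 ℕ.+ suc k′ ℕ.* suc i ≡ suc m ℕ.+ k′ ℕ.+ suc k′ ℕ.* i
        shift′ = ℕ-solve-∀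
      index-zero : ∀ m k′ → m ℕ.+ 0 ℕ.+ suc k′ ℕ.* 0 ≡ m
      index-zero = ℕ-solve-∀
      h-0 : ∀ m → h 0 m ≈ 0#
      h-0 m = trans (*-congʳ (reflexive (≡.cong (intR R) (≡.trans
                (≡.cong (λ t → binomial (+ t) (suc m)) (index-zero m k′))
                (m<j⇒binomial≡0 m (suc m) (ℕP.n<1+n m)))))) (zeroˡ _)
      top-row : ∀ n → f (suc n) 0 + antidiagonal n h ≈ X * antidiagonal n g
      top-row zero = begin
          intR R (+ 1) * (X * 1#) + h 0 0
        ≈⟨ trans (+-congˡ (h-0 0)) (+-identityʳ _) ⟩
          intR R (+ 1) * (X * 1#)
        ≈⟨ solve 3 (λ o X u → o :* (X :* u) := X :* (o :* u)) refl (intR R (+ 1)) X 1# ⟩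
          X * (intR R (+ 1) * 1#)
        ∎
      top-row (suc n) = begin
          f (suc (suc n)) 0 + (h 0 (suc n) + antidiagonal n (λ i m → h (suc i) m))
        ≈⟨ +-congˡ (trans (+-congʳ (h-0 (suc n))) (+-identityˡ _)) ⟩
          intR R (+ 1) * (X * pow R X (suc n)) + antidiagonal n (λ i m → h (suc i) m)
        ≈⟨ +-cong (solve 3 (λ o X p → o :* (X :* p) := X :* (o :* p)) refl (intR R (+ 1)) X (pow R X (suc n)))
                  (antidiagonal-cong n (λ i m → trans (*-congʳ (reflexive (≡.cong (λ t → intR R (binomial (+ t) (suc m))) (index-shift m i))))
                                                       (solve 3 (λ b X p → b :* (X :* p) := X :* (b :* p)) refl _ X _))) ⟩
          X * g (suc n) 0 + antidiagonal n (λ i m → X * g i (suc m))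
        ≈⟨ +-congˡ (antidiagonal-*ˡ n X (λ i m → g i (suc m))) ⟩
          X * g (suc n) 0 + X * antidiagonal n (λ i m → g i (suc m))
        ≈⟨ sym (distribˡ _ _ _) ⟩
          X * (g (suc n) 0 + antidiagonal n (λ i m → g i (suc m)))
        ≈⟨ *-congˡ (sym (antidiagonal-suc n g)) ⟩
          X * antidiagonal (suc n) g
        ∎

    D≈Ψ : ∀ n r → r < k → D (+ suc r) n ≈ Ψ r n
    D≈Ψ zero r _ = sym (trans (*-identityʳ _) (+-identityʳ 1#))
    D≈Ψ (suc n) zero 0<k = begin
      D (+ 1) (suc n)                 ≈⟨ D-suc (+ 0) n ⟩
      D (+ 0) (suc n) + D (+ 1) n     ≈⟨ +-cong (D₀-suc n) (D≈Ψ n 0 0<k) ⟩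
      X * D (+ k) n + Ψ 0 n           ≈⟨ +-congʳ (*-congˡ (D≈Ψ n k′ ℕP.≤-refl)) ⟩
      X * Ψ k′ n + Ψ 0 n              ≈⟨ trans (+-comm _ _) (sym (Ψ₀-suc n)) ⟩
      Ψ 0 (suc n)                     ∎
    D≈Ψ (suc n) (suc r) 1+r<k = begin
      D (+ suc (suc r)) (suc n)                    ≈⟨ D-suc (+ suc r) n ⟩
      D (+ suc r) (suc n) + D (+ suc (suc r)) n    ≈⟨ +-cong (D≈Ψ (suc n) r (ℕP.<-trans (ℕP.n<1+n r) 1+r<k)) (D≈Ψ n (suc r) 1+r<k) ⟩
      Ψ r (suc n) + Ψ (suc r) n                    ≈⟨ sym (Ψ-suc r n) ⟩
      Ψ (suc r) (suc n)                            ∎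

    det-A≈D : ∀ r n → det R n (A R k r n x) ≈ D (+ suc r) n
    det-A≈D r n = begin
        det R n (A R k r n x)          ≈⟨ det-cong n (λ i j → row-of-A (toℕ i) (toℕ j)) ⟩
        det R n (rows (λ i → W i 0))   ≈⟨ det-pascal-rows ⟩
        det R n (rows (λ i → W 0 i))   ≡⟨ ≡.cong (λ t → det R n (λ i j → entry (+ t) (toℕ i) (toℕ j))) (ℕP.+-identityʳ (suc r)) ⟩
        D (+ suc r) n                  ∎
      where
      W : ℕ → ℕ → Row n
      W e s j = entry (+ (suc r ℕ.+ e)) s (toℕ j)
      W-pascal : ∀ e s j → W (suc e) s j ≈ W e s j + W e (suc s) j
      W-pascal e s j = trans (reflexive (≡.cong (λ t → entry (+ t) s (toℕ j)) (ℕP.+-suc (suc r) e))) (entry-pascal (+ (suc r ℕ.+ e)) s (toℕ j))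
      open PascalRows n W W-pascal using (det-pascal-rows)
      lower : ∀ i → + i ℤ.- + k ℤ.+ + 1 ℤ.+ + r ≡ + (suc r ℕ.+ i) ℤ.- + k
      lower i = ≡.trans (reorder (+ i) (+ k) (+ r)) (≡.cong (ℤ._- + k) (≡.sym (ℤP.pos-+ (suc r) i)))
        where
        reorder : ∀ i k r → i ℤ.- k ℤ.+ + 1 ℤ.+ r ≡ (+ 1 ℤ.+ r ℤ.+ i) ℤ.- k
        reorder = ℤ-solve-∀
      upper : ∀ i → + i ℤ.+ + 1 ℤ.+ + r ≡ + (suc r ℕ.+ i)
      upper i = ≡.trans (reorder (+ i) (+ r)) (≡.sym (ℤP.pos-+ (suc r) i))
        where
        reorder : ∀ i r → i ℤ.+ + 1 ℤ.+ r ≡ + 1 ℤ.+ r ℤ.+ i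
        reorder = ℤ-solve-∀
      row-of-A : ∀ i j → intR R (binomℤ (+ i ℤ.- + k ℤ.+ + 1 ℤ.+ + r) j) * X + intR R (binomℤ (+ i ℤ.+ + 1 ℤ.+ + r) (suc j))
                         ≈ entry (+ (suc r ℕ.+ i)) 0 j
      row-of-A i j = reflexive (≡.cong₂ (λ a b → intR R a * X + intR R b)
        (≡.trans (binomℤ≡binomial (+ i ℤ.- + k ℤ.+ + 1 ℤ.+ + r) j) (≡.cong (λ a → binomial a j) (lower i)))
        (≡.trans (binomℤ≡binomial (+ i ℤ.+ + 1 ℤ.+ + r) (suc j)) (≡.cong (λ a → binomial a (suc j)) (upper i))))

    Fib≈x^r*Ψ : ∀ r n → r < k → Fib R k (k ℕ.* n ℕ.+ r) x ≈ pow R x r * Ψ r n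
    Fib≈x^r*Ψ r n r<k = begin
        sumTo R ((k ℕ.* n ℕ.+ r) ℕ./ k) (term n)
      ≡⟨ ≡.cong (λ t → sumTo R t (term n)) [kn+r]/k≡n ⟩
        sumTo R n (term n)
      ≈⟨ sumTo-cong-≤ n (term n) (term′ n) (λ m m≤n → ≡.subst (λ t → term t m ≈ term′ t m) (ℕP.m+[n∸m]≡n m≤n) (term≈term′ m (n ∸ m))) ⟩
        sumTo R n (term′ n)
      ≈⟨ sumTo-*ˡ n (pow R x r) _ ⟩
        pow R x r * sumTo R n (λ m → intR R (binomial (+ (m ℕ.+ r ℕ.+ k ℕ.* (n ∸ m))) m) * pow R X (n ∸ m))
      ≈⟨ *-congˡ (sym (antidiagonal≈sumTo n _)) ⟩
        pow R x r * Ψ r n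
      ∎
      where
      [kn+r]/k≡n : (k ℕ.* n ℕ.+ r) ℕ./ k ≡ n
      [kn+r]/k≡n = ≡.trans (ℕD.+-distrib-/-∣ˡ r (ℕDiv.m∣m*n n)) (≡.trans (≡.cong₂ ℕ._+_ kn/k≡n (ℕD.m<n⇒m/n≡0 r<k)) (ℕP.+-identityʳ n))
        where
        kn/k≡n : k ℕ.* n ℕ./ k ≡ n
        kn/k≡n = ≡.trans (≡.cong (ℕ._/ k) (ℕP.*-comm k n)) (ℕD.m*n/n≡m n k)
      term term′ : ℕ → ℕ → Carrier
      term n m = intR R (binomℤ (+ (k ℕ.* n ℕ.+ r) ℤ.- + (k′ ℕ.* m)) m) * pow R x (k ℕ.* n ℕ.+ r ∸ k ℕ.* m)
      term′ n m = pow R x r * (intR R (binomial (+ (m ℕ.+ r ℕ.+ k ℕ.* (n ∸ m))) m) * pow R X (n ∸ m))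
      term≈term′ : ∀ m d → term (m ℕ.+ d) m ≈ term′ (m ℕ.+ d) m
      term≈term′ m d = begin
          intR R (binomℤ (+ (k ℕ.* (m ℕ.+ d) ℕ.+ r) ℤ.- + (k′ ℕ.* m)) m) * pow R x (k ℕ.* (m ℕ.+ d) ℕ.+ r ∸ k ℕ.* m)
        ≡⟨ ≡.cong₂ (λ a e → intR R a * pow R x e) coefficient exponent ⟩
          intR R (binomial (+ (m ℕ.+ r ℕ.+ k ℕ.* d)) m) * pow R x (k ℕ.* d ℕ.+ r)
        ≈⟨ *-congˡ (trans (pow-+ x (k ℕ.* d) r) (*-congʳ (pow-* x k d))) ⟩
          intR R (binomial (+ (m ℕ.+ r ℕ.+ k ℕ.* d)) m) * (pow R X d * pow R x r)
        ≈⟨ solve 3 (λ b p q → b :* (p :* q) := q :* (b :* p)) refl _ _ _ ⟩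
          pow R x r * (intR R (binomial (+ (m ℕ.+ r ℕ.+ k ℕ.* d)) m) * pow R X d)
        ≡⟨ ≡.cong (λ t → pow R x r * (intR R (binomial (+ (m ℕ.+ r ℕ.+ k ℕ.* t)) m) * pow R X t)) (≡.sym (ℕP.m+n∸m≡n m d)) ⟩
          term′ (m ℕ.+ d) m
        ∎
        where
        regroup : ∀ k′ m d r → suc k′ ℕ.* (m ℕ.+ d) ℕ.+ r ≡ (m ℕ.+ r ℕ.+ suc k′ ℕ.* d) ℕ.+ k′ ℕ.* m
        regroup = ℕ-solve-∀
        regroup′ : ∀ k′ m d r → suc k′ ℕ.* (m ℕ.+ d) ℕ.+ r ≡ suc k′ ℕ.* m ℕ.+ (suc k′ ℕ.* d ℕ.+ r)
        regroup′ = ℕ-solve-∀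
        [a+b]-b≡a : ∀ a b → + (a ℕ.+ b) ℤ.- + b ≡ + a
        [a+b]-b≡a a b = ≡.trans (≡.cong (ℤ._- + b) (ℤP.pos-+ a b)) (cancel (+ a) (+ b))
          where
          cancel : ∀ a b → (a ℤ.+ b) ℤ.- b ≡ a
          cancel = ℤ-solve-∀
        upper-index : + (k ℕ.* (m ℕ.+ d) ℕ.+ r) ℤ.- + (k′ ℕ.* m) ≡ + (m ℕ.+ r ℕ.+ k ℕ.* d)
        upper-index = ≡.trans (≡.cong (λ t → + t ℤ.- + (k′ ℕ.* m)) (regroup k′ m d r)) ([a+b]-b≡a (m ℕ.+ r ℕ.+ k ℕ.* d) (k′ ℕ.* m))
        coefficient : binomℤ (+ (k ℕ.* (m ℕ.+ d) ℕ.+ r) ℤ.- + (k′ ℕ.* m)) m ≡ binomial (+ (m ℕ.+ r ℕ.+ k ℕ.* d)) m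
        coefficient = ≡.trans (binomℤ≡binomial (+ (k ℕ.* (m ℕ.+ d) ℕ.+ r) ℤ.- + (k′ ℕ.* m)) m) (≡.cong (λ a → binomial a m) upper-index)
        exponent : k ℕ.* (m ℕ.+ d) ℕ.+ r ∸ k ℕ.* m ≡ k ℕ.* d ℕ.+ r
        exponent = ≡.trans (≡.cong (_∸ k ℕ.* m) (regroup′ k′ m d r)) (ℕP.m+n∸m≡n (k ℕ.* m) _)

    x^r*det-A≈Fib : ∀ r n → r < k → pow R x r * det R n (A R k r n x) ≈ Fib R k (k ℕ.* n ℕ.+ r) x
    x^r*det-A≈Fib r n r<k = begin
      pow R x r * det R n (A R k r n x)   ≈⟨ *-congˡ (trans (det-A≈D r n) (D≈Ψ n r r<k)) ⟩
      pow R x r * Ψ r n                   ≈⟨ sym (Fib≈x^r*Ψ r n r<k) ⟩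
      Fib R k (k ℕ.* n ℕ.+ r) x           ∎

open import Data.Nat using (_+_; _*_)

theorem1 : {c ℓ : Level} (R : CommutativeRing c ℓ) (x : CommutativeRing.Carrier R)
    (k r n : ℕ) → 1 ≤ k → r < k →
    CommutativeRing._≈_ R
      (CommutativeRing._*_ R (pow R x r) (det R n (A R k r n x)))
      (Fib R k (k * n + r) x)
theorem1 R x zero r n () _
theorem1 R x (suc k′) r n _ r<k = x^r*det-A≈Fib R x k′ r n r<k
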